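{- Let $p$ be a prime and let $A=(a_1,\dots,a_\ell)$ be a sequence of $\ell > p$ nonzero elements of $\mathbb{F}_p$. Then $\dim(A)=\ell-1$.
   Context: For a sequence $A=(a_1,\dots,a_\ell)$ of nonzero elements of $\mathbb{F}_p$, let $\mathcal{S}_A=\{x\in\{0,1\}^\ell : a_1x_1+\dots+a_\ell x_\ell=0 \text{ in } \mathbb{F}_p\}$ be the set of $0$-$1$ solutions of the equation $a_1x_1+\dots+a_\ell x_\ell=0$, viewed as vectors of $\mathbb{F}_p^\ell$, and let $\dim(A)$ denote the dimension of the $\mathbb{F}_p$-linear span $\langle\mathcal{S}_A\rangle\subseteq\mathbb{F}_p^\ell$. -}

module Defs where

open import Data.Nat using (ℕ; zero; suc)
open import Data.Fin using (Fin; zero; suc)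
open import Data.Bool using (Bool; true; false)
open import Data.Integer using (ℤ; +_; _+_; _-_; _*_)
open import Data.Integer.Divisibility using (_∣_)
open import Data.Product using (Σ; ∃; _×_; _,_)
open import Data.Empty using (⊥)

-- Elements of F_p are represented by integers; equality in F_p is
-- congruence modulo p.
infix 4 _≡[mod_]_
_≡[mod_]_ : ℤ → ℕ → ℤ → Set
a ≡[mod p ] b = (+ p) ∣ (a - b)

Vec𝔽 : ℕ → Set
Vec𝔽 ℓ = Fin ℓ → ℤ

infix 4 _≈[_]_
_≈[_]_ : {ℓ : ℕ} → Vec𝔽 ℓ → ℕ → Vec𝔽 ℓ → Set
u ≈[ p ] v = ∀ i → u i ≡[mod p ] v i

∑ : (n : ℕ) → (Fin n → ℤ) → ℤ
∑ zero    f = + 0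
∑ (suc n) f = f zero + ∑ n (λ i → f (suc i))

lincomb : {ℓ : ℕ} (m : ℕ) → (Fin m → ℤ) → (Fin m → Vec𝔽 ℓ) → Vec𝔽 ℓ
lincomb m c v j = ∑ m (λ k → c k * v k j)

bit : Bool → ℤ
bit true  = + 1
bit false = + 0

toVec : {ℓ : ℕ} → (Fin ℓ → Bool) → Vec𝔽 ℓ
toVec x i = bit (x i)

AllNonzero : (p ℓ : ℕ) → (Fin ℓ → ℤ) → Set
AllNonzero p ℓ a = ∀ i → (a i ≡[mod p ] + 0 → ⊥)

IsSol : (p ℓ : ℕ) → (Fin ℓ → ℤ) → (Fin ℓ → Bool) → Set
IsSol p ℓ a x = ∑ ℓ (λ i → a i * bit (x i)) ≡[mod p ] + 0

InS : (p ℓ : ℕ) → (Fin ℓ → ℤ) → Vec𝔽 ℓ → Set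
InS p ℓ a v = Σ (Fin ℓ → Bool) λ x → IsSol p ℓ a x × (v ≈[ p ] toVec x)

InSpan : (p ℓ : ℕ) → (Vec𝔽 ℓ → Set) → Vec𝔽 ℓ → Set
InSpan p ℓ S v =
  Σ ℕ λ m → Σ (Fin m → ℤ) λ c → Σ (Fin m → Vec𝔽 ℓ) λ w →
    (∀ k → S (w k)) × (v ≈[ p ] lincomb m c w)

LinIndep : (p ℓ d : ℕ) → (Fin d → Vec𝔽 ℓ) → Set
LinIndep p ℓ d b =
  ∀ (c : Fin d → ℤ) → lincomb d c b ≈[ p ] (λ _ → + 0) → ∀ k → c k ≡[mod p ] + 0

HasDim : (p ℓ : ℕ) → (Vec𝔽 ℓ → Set) → ℕ → Set
HasDim p ℓ V d =
  Σ (Fin d → Vec𝔽 ℓ) λ b →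
    (∀ k → V (b k)) × LinIndep p ℓ d b ×
    (∀ v → V v → Σ (Fin d → ℤ) λ c → v ≈[ p ] lincomb d c b)

DimIs : (p ℓ : ℕ) → (Fin ℓ → ℤ) → ℕ → Set
DimIs p ℓ a d = HasDim p ℓ (InSpan p ℓ (InS p ℓ a)) d

module Submission where

-- The span lies in the hyperplane (Span-orthogonal), and the hyperplane has
-- the basis b k = a₀ e_{k+1} − a_{k+1} e₀; so it suffices to put each b k in
-- the span.  This is the polynomial method: g(y) = (y−1)⋯(y−(p−1)) vanishes at
-- every nonzero residue, so g(a·x) x is in the span for every 0-1 vector x.
-- The inclusion–exclusion V S of these vectors over the subsets of p
-- coordinates S has as coordinates (p−1)-fold differences of g, i.e. the
-- nonzero constants (p−1)! ∏ a_t; two such sums whose sets differ only in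
-- s versus s′ combine to a nonzero multiple of a_{s′} e_s − a_s e_{s′}.

open import Defs
open import Data.Nat as ℕ using (ℕ; zero; suc; _<_; _≤_; _∸_; z≤n; s≤s; _!)
import Data.Nat.Properties as ℕₚ
import Data.Nat.Divisibility as ℕ∣
open import Data.Nat.Primality using (Prime; euclidsLemma; prime⇒nonZero; prime⇒nonTrivial)
open import Data.Nat.Coprimality using (prime⇒coprime; coprime-Bézout)
open import Data.Nat.GCD using (module Bézout)
open import Data.Integer using (ℤ; +_; _+_; _-_; _*_; -_; ∣_∣)
import Data.Integer.Properties as ℤₚ
import Data.Integer.Divisibility.Signed as Signed
open import Data.Integer.DivMod using (_%ℕ_; _/ℕ_; a≡a%ℕn+[a/ℕn]*n; n%ℕd<d)
open import Data.Integer.Tactic.RingSolver using (solve-∀)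
open import Data.Fin using (Fin; zero; suc; splitAt; _≟_; punchIn; inject≤)
import Data.Fin.Properties as Finₚ
open import Data.Vec.Functional using (_++_; updateAt)
open import Data.Vec.Functional.Properties using (updateAt-updates; updateAt-minimal)
open import Data.List.Properties using (length-map; length-removeAt; length-tabulate)
open import Data.List.Relation.Unary.All as All using (All; []; _∷_)
open import Data.List.Relation.Unary.All.Properties using (All¬⇒¬Any; tabulate⁺)
open import Data.List.Relation.Unary.Any using (here; there; index)
open import Data.List.Relation.Unary.Unique.Propositional using (Unique; []; _∷_)
import Data.List.Relation.Unary.Unique.Propositional.Properties as Unique
open import Data.List.Membership.Propositional using (_∈_; _∉_; _─_)
import Data.List.Membership.DecPropositional as DecMembership
open import Data.Sum as Sum using (_⊎_; inj₁; inj₂)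
open import Data.Sum.Properties using ([,]-map)
open import Function using (_∘_)
open import Algebra.Properties.Semiring.Sum ℤₚ.+-*-semiring
  using (sum; sum-cong-≗; sum-replicate-zero; ∑-comm; *-distribˡ-sum)
open import Data.Product using (Σ; _,_; proj₁; proj₂)
open import Data.Bool using (Bool; true; false)
open import Data.List using (List; []; _∷_; length; foldr; map; tabulate)
open import Data.Empty using (⊥-elim)
open import Relation.Binary using (IsEquivalence; Setoid)
import Relation.Binary.Reasoning.Setoid as SetoidReasoning
open import Relation.Binary.PropositionalEquality
  using (_≡_; _≢_; refl; sym; trans; cong; cong₂; subst; module ≡-Reasoning)
open import Relation.Nullary using (¬_; Dec; yes; no)

∑≡sum : ∀ n (f : Fin n → ℤ) → ∑ n f ≡ sum f
∑≡sum zero    f = refl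
∑≡sum (suc n) f = cong (_+_ (f zero)) (∑≡sum n (f ∘ suc))

∑-ext : ∀ n {f g : Fin n → ℤ} → (∀ i → f i ≡ g i) → ∑ n f ≡ ∑ n g
∑-ext n {f} {g} f≗g = begin
  ∑ n f  ≡⟨ ∑≡sum n f ⟩
  sum f  ≡⟨ sum-cong-≗ f≗g ⟩
  sum g  ≡⟨ ∑≡sum n g ⟨
  ∑ n g  ∎
  where open ≡-Reasoning

∑-zero : ∀ n → ∑ n (λ _ → + 0) ≡ + 0
∑-zero n = trans (∑≡sum n _) (sum-replicate-zero n)

∑-*ˡ : ∀ n c (f : Fin n → ℤ) → ∑ n (λ i → c * f i) ≡ c * ∑ n f
∑-*ˡ n c f = begin
  ∑ n (λ i → c * f i)  ≡⟨ ∑≡sum n _ ⟩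
  sum (λ i → c * f i)  ≡⟨ *-distribˡ-sum c f ⟨
  c * sum f            ≡⟨ cong (c *_) (∑≡sum n f) ⟨
  c * ∑ n f            ∎
  where open ≡-Reasoning

∑-swap : ∀ m n (f : Fin m → Fin n → ℤ) →
         ∑ m (λ i → ∑ n (f i)) ≡ ∑ n (λ j → ∑ m (λ i → f i j))
∑-swap m n f = begin
  ∑ m (λ i → ∑ n (f i))            ≡⟨ ∑≡sum m _ ⟩
  sum (λ i → ∑ n (f i))            ≡⟨ sum-cong-≗ (λ i → ∑≡sum n (f i)) ⟩
  sum (λ i → sum (f i))            ≡⟨ ∑-comm f ⟩
  sum (λ j → sum (λ i → f i j))    ≡⟨ sum-cong-≗ {n} (λ j → ∑≡sum m (λ i → f i j)) ⟨
  sum (λ j → ∑ m (λ i → f i j))    ≡⟨ ∑≡sum n _ ⟨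
  ∑ n (λ j → ∑ m (λ i → f i j))    ∎
  where open ≡-Reasoning

∑-++ : ∀ m {n} (f : Fin m → ℤ) (g : Fin n → ℤ) → ∑ (m ℕ.+ n) (f ++ g) ≡ ∑ m f + ∑ n g
∑-++ zero    f g = sym (ℤₚ.+-identityˡ _)
∑-++ (suc m) f g = begin
  f zero + ∑ (m ℕ.+ _) (λ i → (f ++ g) (suc i))
    ≡⟨ cong (_+_ (f zero)) (∑-ext (m ℕ.+ _) (λ i → [,]-map (splitAt m i))) ⟩
  f zero + ∑ (m ℕ.+ _) ((f ∘ suc) ++ g)          ≡⟨ cong (_+_ (f zero)) (∑-++ m (f ∘ suc) g) ⟩
  f zero + (∑ m (f ∘ suc) + ∑ _ g)               ≡⟨ ℤₚ.+-assoc (f zero) _ _ ⟨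
  f zero + ∑ m (f ∘ suc) + ∑ _ g                 ∎
  where open ≡-Reasoning

δ : ∀ {n} → Fin n → Fin n → ℤ
δ zero    zero    = + 1
δ zero    (suc _) = + 0
δ (suc _) zero    = + 0
δ (suc i) (suc j) = δ i j

δ-diag : ∀ {n} (i : Fin n) → δ i i ≡ + 1
δ-diag zero    = refl
δ-diag (suc i) = δ-diag i

δ-off : ∀ {n} (i j : Fin n) → i ≢ j → δ i j ≡ + 0
δ-off zero    zero    i≢j = ⊥-elim (i≢j refl)
δ-off zero    (suc j) _   = refl
δ-off (suc i) zero    _   = refl
δ-off (suc i) (suc j) i≢j = δ-off i j (i≢j ∘ cong suc)

∑-δ : ∀ n (f : Fin n → ℤ) k → ∑ n (λ i → f i * δ i k) ≡ f k
∑-δ (suc n) f zero = begin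
  f zero * + 1 + ∑ n (λ i → f (suc i) * + 0)
    ≡⟨ cong₂ _+_ (ℤₚ.*-identityʳ (f zero)) (∑-ext n (λ i → ℤₚ.*-zeroʳ (f (suc i)))) ⟩
  f zero + ∑ n (λ _ → + 0)                    ≡⟨ cong (_+_ (f zero)) (∑-zero n) ⟩
  f zero + + 0                                ≡⟨ ℤₚ.+-identityʳ (f zero) ⟩
  f zero                                      ∎
  where open ≡-Reasoning
∑-δ (suc n) f (suc k) = begin
  f zero * + 0 + ∑ n (λ i → f (suc i) * δ i k)  ≡⟨ cong₂ _+_ (ℤₚ.*-zeroʳ (f zero)) (∑-δ n (f ∘ suc) k) ⟩
  + 0 + f (suc k)                               ≡⟨ ℤₚ.+-identityˡ (f (suc k)) ⟩
  f (suc k)                                     ∎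
  where open ≡-Reasoning

_·_ : ∀ {ℓ} → Vec𝔽 ℓ → Vec𝔽 ℓ → ℤ
_·_ {ℓ} a v = ∑ ℓ (λ j → a j * v j)

·-lincomb : ∀ {ℓ} (a : Vec𝔽 ℓ) m c (w : Fin m → Vec𝔽 ℓ) →
            a · lincomb m c w ≡ ∑ m (λ k → c k * (a · w k))
·-lincomb {ℓ} a m c w = begin
  ∑ ℓ (λ j → a j * ∑ m (λ k → c k * w k j))   ≡⟨ ∑-ext ℓ (λ j → sym (∑-*ˡ m (a j) _)) ⟩
  ∑ ℓ (λ j → ∑ m (λ k → a j * (c k * w k j))) ≡⟨ ∑-swap ℓ m _ ⟩
  ∑ m (λ k → ∑ ℓ (λ j → a j * (c k * w k j)))
    ≡⟨ ∑-ext m (λ k → trans (∑-ext ℓ (λ j → exchange (a j) (c k) (w k j))) (∑-*ˡ ℓ (c k) _)) ⟩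
  ∑ m (λ k → c k * (a · w k))                 ∎
  where open ≡-Reasoning
        exchange : ∀ x y z → x * (y * z) ≡ y * (x * z)
        exchange = solve-∀

lincomb-++ : ∀ {ℓ} m {n} (c : Fin m → ℤ) (c′ : Fin n → ℤ)
               (w : Fin m → Vec𝔽 ℓ) (w′ : Fin n → Vec𝔽 ℓ) j →
             lincomb (m ℕ.+ n) (c ++ c′) (w ++ w′) j ≡ lincomb m c w j + lincomb n c′ w′ j
lincomb-++ m c c′ w w′ j =
  trans (∑-ext (m ℕ.+ _) (λ k → zip (splitAt m k))) (∑-++ m (λ k → c k * w k j) (λ k → c′ k * w′ k j))
  where zip : ∀ x → Sum.[ c , c′ ]′ x * Sum.[ w , w′ ]′ x j
                  ≡ Sum.[ (λ k → c k * w k j) , (λ k → c′ k * w′ k j) ]′ x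
        zip (inj₁ k) = refl
        zip (inj₂ k) = refl

lincomb-scale : ∀ {ℓ} m d (c : Fin m → ℤ) (w : Fin m → Vec𝔽 ℓ) j →
                lincomb m (λ k → d * c k) w j ≡ d * lincomb m c w j
lincomb-scale m d c w j = trans (∑-ext m (λ k → ℤₚ.*-assoc d (c k) (w k j))) (∑-*ˡ m d _)

Δ : ℤ → (ℤ → ℤ) → ℤ → ℤ
Δ b f y = f (y + b) - f y

-- Poly m c f : f is an integer polynomial function of degree ≤ m whose
-- coefficient of yᵐ is c.
data Poly : ℕ → ℤ → (ℤ → ℤ) → Set where
  constant    : ∀ {c f} → (∀ y → f y ≡ c) → Poly zero c f
  differences : ∀ {m c f} → (∀ b → Poly m (+ suc m * c * b) (Δ b f)) → Poly (suc m) c f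

Poly-ext : ∀ {m c f g} → (∀ y → f y ≡ g y) → Poly m c f → Poly m c g
Poly-ext f≗g (constant f≡c) = constant (λ y → trans (sym (f≗g y)) (f≡c y))
Poly-ext f≗g (differences Δf) =
  differences (λ b → Poly-ext (λ y → cong₂ _-_ (f≗g (y + b)) (f≗g y)) (Δf b))

Poly-coeff : ∀ {m c d f} → c ≡ d → Poly m c f → Poly m d f
Poly-coeff refl P = P

Poly-+ : ∀ {m c d f g} → Poly m c f → Poly m d g → Poly m (c + d) (λ y → f y + g y)
Poly-+ (constant f≡c) (constant g≡d) = constant (λ y → cong₂ _+_ (f≡c y) (g≡d y))
Poly-+ {suc m} {c} {d} {f} {g} (differences Δf) (differences Δg) = differences λ b →
  Poly-ext (λ y → regroup (f (y + b)) (g (y + b)) (f y) (g y))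
    (Poly-coeff (distrib (+ suc m) c d b) (Poly-+ (Δf b) (Δg b)))
  where regroup : ∀ x y z w → (x - z) + (y - w) ≡ (x + y) - (z + w)
        regroup = solve-∀
        distrib : ∀ k c d b → k * c * b + k * d * b ≡ k * (c + d) * b
        distrib = solve-∀

Poly-scale : ∀ {m c f} s → Poly m c f → Poly m (s * c) (λ y → s * f y)
Poly-scale s (constant f≡c) = constant (λ y → cong (s *_) (f≡c y))
Poly-scale {suc m} {c} {f} s (differences Δf) = differences λ b →
  Poly-ext (λ y → distrib s (f (y + b)) (f y)) (Poly-coeff (exchange (+ suc m) s c b) (Poly-scale s (Δf b)))
  where distrib : ∀ s x y → s * (x - y) ≡ s * x - s * y
        distrib = solve-∀
        exchange : ∀ k s c b → s * (k * c * b) ≡ k * (s * c) * b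
        exchange = solve-∀

Poly-shift : ∀ {m c f} t → Poly m c f → Poly m c (λ y → f (y + t))
Poly-shift t (constant f≡c) = constant (λ y → f≡c (y + t))
Poly-shift {f = f} t (differences Δf) = differences λ b →
  Poly-ext (λ y → cong (λ z → f z - f (y + t)) (swap y t b)) (Poly-shift t (Δf b))
  where swap : ∀ y t b → y + t + b ≡ y + b + t
        swap = solve-∀

-- Multiplying by a monic linear factor raises the degree and keeps the
-- leading coefficient, by the product rule
--   Δ b ((· - e) f) y = (y - e) Δ b f y + b f (y + b).
Poly-linear-factor : ∀ {m c f} e → Poly m c f → Poly (suc m) c (λ y → (y - e) * f y)
Poly-linear-factor {c = c} {f} e (constant f≡c) = differences λ b → constant λ y → begin
  (y + b - e) * f (y + b) - (y - e) * f y  ≡⟨ cong₂ (λ u v → (y + b - e) * u - (y - e) * v) (f≡c (y + b)) (f≡c y) ⟩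
  (y + b - e) * c - (y - e) * c            ≡⟨ difference y b e c ⟩
  + 1 * c * b                              ∎
  where open ≡-Reasoning
        difference : ∀ y b e c → (y + b - e) * c - (y - e) * c ≡ + 1 * c * b
        difference = solve-∀
Poly-linear-factor {suc m} {c} {f} e (differences Δf) = differences λ b →
  Poly-ext (λ y → product-rule y b e (f (y + b)) (f y))
    (Poly-coeff (coefficient (+ suc m) c b)
      (Poly-+ (Poly-linear-factor e (Δf b)) (Poly-scale b (Poly-shift {f = f} b (differences Δf)))))
  where product-rule : ∀ y b e u v → (y - e) * (u - v) + b * u ≡ (y + b - e) * u - (y - e) * v
        product-rule = solve-∀
        coefficient : ∀ k c b → k * c * b + b * c ≡ (+ 1 + k) * c * b
        coefficient = solve-∀

Δ* : List ℤ → (ℤ → ℤ) → ℤ → ℤ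
Δ* []       f x = f x
Δ* (b ∷ bs) f x = Δ* bs f (x + b) - Δ* bs f x

Δ*-Δ : ∀ bs b f x → Δ* bs (Δ b f) x ≡ Δ* (b ∷ bs) f x
Δ*-Δ []       b f x = refl
Δ*-Δ (c ∷ bs) b f x = begin
  Δ* bs (Δ b f) (x + c) - Δ* bs (Δ b f) x
    ≡⟨ cong₂ _-_ (Δ*-Δ bs b f (x + c)) (Δ*-Δ bs b f x) ⟩
  (Δ* bs f (x + c + b) - Δ* bs f (x + c)) - (Δ* bs f (x + b) - Δ* bs f x)
    ≡⟨ cong (λ z → (Δ* bs f z - Δ* bs f (x + c)) - (Δ* bs f (x + b) - Δ* bs f x)) (swap x c b) ⟩
  (Δ* bs f (x + b + c) - Δ* bs f (x + c)) - (Δ* bs f (x + b) - Δ* bs f x)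
    ≡⟨ regroup (Δ* bs f (x + b + c)) (Δ* bs f (x + c)) (Δ* bs f (x + b)) (Δ* bs f x) ⟩
  (Δ* bs f (x + b + c) - Δ* bs f (x + b)) - (Δ* bs f (x + c) - Δ* bs f x)
    ∎
  where open ≡-Reasoning
        swap : ∀ x c b → x + c + b ≡ x + b + c
        swap = solve-∀
        regroup : ∀ u v w z → (u - v) - (w - z) ≡ (u - w) - (v - z)
        regroup = solve-∀

∏ : List ℤ → ℤ
∏ = foldr _*_ (+ 1)

Δ*-Poly : ∀ bs {m c f} → length bs ≡ m → Poly m c f → ∀ x → Δ* bs f x ≡ + (m !) * c * ∏ bs
Δ*-Poly [] refl (constant f≡c) x = trans (f≡c x) (unit _)
  where unit : ∀ c → c ≡ + 1 * c * + 1
        unit = solve-∀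
Δ*-Poly (b ∷ bs) {c = c} {f} refl (differences Δf) x = begin
  Δ* (b ∷ bs) f x                                     ≡⟨ Δ*-Δ bs b f x ⟨
  Δ* bs (Δ b f) x                                     ≡⟨ Δ*-Poly bs refl (Δf b) x ⟩
  + (m !) * (+ suc m * c * b) * ∏ bs                  ≡⟨ regroup (+ (m !)) (+ suc m) c b (∏ bs) ⟩
  + suc m * + (m !) * c * (b * ∏ bs)                  ≡⟨ cong (λ z → z * c * (b * ∏ bs)) (ℤₚ.pos-* (suc m) (m !)) ⟨
  + (suc m !) * c * ∏ (b ∷ bs)                        ∎
  where open ≡-Reasoning
        m : ℕ
        m = length bs
        regroup : ∀ F k c b P → F * (k * c * b) * P ≡ k * F * c * (b * P)
        regroup = solve-∀

roots≤ : ℕ → ℤ → ℤ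
roots≤ zero    y = + 1
roots≤ (suc m) y = (y - + suc m) * roots≤ m y

roots≤-Poly : ∀ m → Poly m (+ 1) (roots≤ m)
roots≤-Poly zero    = constant (λ _ → refl)
roots≤-Poly (suc m) = Poly-linear-factor (+ suc m) (roots≤-Poly m)

switchOn : ∀ {n} → (Fin n → Bool) → Fin n → Fin n → Bool
switchOn u t = updateAt u t (λ _ → true)

·-switchOn : ∀ {n} (a : Vec𝔽 n) u t → u t ≡ false → a · toVec (switchOn u t) ≡ a · toVec u + a t
·-switchOn {suc n} a u zero u₀≡false rewrite u₀≡false = switch (a zero) (∑ n (λ i → a (suc i) * bit (u (suc i))))
  where switch : ∀ x s → x * + 1 + s ≡ x * + 0 + s + x
        switch = solve-∀
·-switchOn {suc n} a u (suc t) uₜ≡false = begin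
  a zero * bit (u zero) + (a ∘ suc) · toVec (switchOn (u ∘ suc) t)
    ≡⟨ cong (_+_ (a zero * bit (u zero))) (·-switchOn (a ∘ suc) (u ∘ suc) t uₜ≡false) ⟩
  a zero * bit (u zero) + ((a ∘ suc) · toVec (u ∘ suc) + a (suc t))  ≡⟨ ℤₚ.+-assoc (a zero * bit (u zero)) _ _ ⟨
  a · toVec u + a (suc t)                                            ∎
  where open ≡-Reasoning

-- For a list S of coordinates
-- and a 0-1 vector u (off on S),
--   V S u = Σ_{T ⊆ S} (-1)^{|S∖T|} g(a·(u+T)) (u+T),
-- an inclusion–exclusion of the vectors g(a·x) x.  Its coordinates are
-- iterated differences of g, which is how the degree of g enters.
module AlternatingSums {ℓ : ℕ} (a : Vec𝔽 ℓ) (g : ℤ → ℤ) where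

  σ : (Fin ℓ → Bool) → ℤ
  σ u = a · toVec u

  V : List (Fin ℓ) → (Fin ℓ → Bool) → Vec𝔽 ℓ
  V []      u j = g (σ u) * bit (u j)
  V (t ∷ S) u j = V S (switchOn u t) j - V S u j

  Off : (Fin ℓ → Bool) → List (Fin ℓ) → Set
  Off u = All (λ t → u t ≡ false)

  switchOn-Off : ∀ {u t} S → All (t ≢_) S → Off u S → Off (switchOn u t) S
  switchOn-Off {u} {t} S t∉S u-off =
    All.zipWith (λ (t≢s , uₛ≡false) → trans (updateAt-minimal _ t u (t≢s ∘ sym)) uₛ≡false) (t∉S , u-off)

  V-outside : ∀ S u j → Unique S → Off u S → j ∉ S →
              V S u j ≡ Δ* (map a S) g (σ u) * bit (u j)
  V-outside []      u j _ _ _ = refl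
  V-outside (t ∷ S) u j (t∉S ∷ S-unique) (uₜ≡false ∷ u-off) j∉ = begin
    V S (switchOn u t) j - V S u j
      ≡⟨ cong₂ _-_ (V-outside S (switchOn u t) j S-unique (switchOn-Off S t∉S u-off) (j∉ ∘ there))
                   (V-outside S u j S-unique u-off (j∉ ∘ there)) ⟩
    D (σ (switchOn u t)) * bit (switchOn u t j) - D (σ u) * bit (u j)
      ≡⟨ cong₂ (λ x y → D x * bit y - D (σ u) * bit (u j))
               (·-switchOn a u t uₜ≡false) (updateAt-minimal j t u (j∉ ∘ here)) ⟩
    D (σ u + a t) * bit (u j) - D (σ u) * bit (u j)
      ≡⟨ factor (D (σ u + a t)) (D (σ u)) (bit (u j)) ⟩
    (D (σ u + a t) - D (σ u)) * bit (u j)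
      ∎
    where open ≡-Reasoning
          D : ℤ → ℤ
          D = Δ* (map a S) g
          factor : ∀ x y z → x * z - y * z ≡ (x - y) * z
          factor = solve-∀

  V-inside : ∀ S u j → Unique S → Off u S → (j∈S : j ∈ S) →
             V S u j ≡ Δ* (map a (S ─ j∈S)) g (σ u + a j)
  V-inside (t ∷ S) u .t (t∉S ∷ S-unique) (uₜ≡false ∷ u-off) (here refl) = begin
    V S (switchOn u t) t - V S u t
      ≡⟨ cong₂ _-_ (V-outside S (switchOn u t) t S-unique (switchOn-Off S t∉S u-off) (All¬⇒¬Any t∉S))
                   (V-outside S u t S-unique u-off (All¬⇒¬Any t∉S)) ⟩
    D (σ (switchOn u t)) * bit (switchOn u t t) - D (σ u) * bit (u t)
      ≡⟨ cong₂ (λ x y → D x * bit y - D (σ u) * bit (u t)) (·-switchOn a u t uₜ≡false) (updateAt-updates t u) ⟩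
    D (σ u + a t) * + 1 - D (σ u) * bit (u t)
      ≡⟨ cong (λ z → D (σ u + a t) * + 1 - D (σ u) * bit z) uₜ≡false ⟩
    D (σ u + a t) * + 1 - D (σ u) * + 0
      ≡⟨ simplify (D (σ u + a t)) (D (σ u)) ⟩
    D (σ u + a t)
      ∎
    where open ≡-Reasoning
          D : ℤ → ℤ
          D = Δ* (map a S) g
          simplify : ∀ x y → x * + 1 - y * + 0 ≡ x
          simplify = solve-∀
  V-inside (t ∷ S) u j (t∉S ∷ S-unique) (uₜ≡false ∷ u-off) (there j∈S) = begin
    V S (switchOn u t) j - V S u j
      ≡⟨ cong₂ _-_ (V-inside S (switchOn u t) j S-unique (switchOn-Off S t∉S u-off) j∈S)
                   (V-inside S u j S-unique u-off j∈S) ⟩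
    D (σ (switchOn u t) + a j) - D (σ u + a j)
      ≡⟨ cong (λ x → D (x + a j) - D (σ u + a j)) (·-switchOn a u t uₜ≡false) ⟩
    D (σ u + a t + a j) - D (σ u + a j)
      ≡⟨ cong (λ x → D x - D (σ u + a j)) (swap (σ u) (a t) (a j)) ⟩
    D (σ u + a j + a t) - D (σ u + a j)
      ∎
    where open ≡-Reasoning
          D : ℤ → ℤ
          D = Δ* (map a (S ─ j∈S)) g
          swap : ∀ x y z → x + y + z ≡ x + z + y
          swap = solve-∀

  off : Fin ℓ → Bool
  off _ = false

  V-off-outside : ∀ S j → Unique S → j ∉ S → V S off j ≡ + 0
  V-off-outside S j S-unique j∉S =
    trans (V-outside S off j S-unique (All.universal (λ _ → refl) S) j∉S) (ℤₚ.*-zeroʳ (Δ* (map a S) g (σ off)))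

  module _ {m c} (g-poly : Poly m c g) where

    V-off-inside : ∀ S j → Unique S → length S ≡ suc m → (j∈S : j ∈ S) →
                   V S off j ≡ + (m !) * c * ∏ (map a (S ─ j∈S))
    V-off-inside S j S-unique |S|≡1+m j∈S =
      trans (V-inside S off j S-unique (All.universal (λ _ → refl) S) j∈S) (Δ*-Poly (map a (S ─ j∈S)) length≡m g-poly _)
      where length≡m : length (map a (S ─ j∈S)) ≡ m
            length≡m = trans (length-map a (S ─ j∈S)) (trans (length-removeAt S (index j∈S)) (cong ℕ.pred |S|≡1+m))

    pair-combination : ∀ s s′ Q → Unique (s ∷ s′ ∷ Q) → length Q ≡ m → ∀ j →
      a s′ * V (s ∷ Q) off j - a s * V (s′ ∷ Q) off j ≡ + (m !) * c * ∏ (map a Q) * (a s′ * δ s j - a s * δ s′ j)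
    pair-combination s s′ Q ((s≢s′ ∷ s≢Q) ∷ s′≢Q ∷ Q-unique) |Q|≡m j = by-cases j (j ≟ s) (j ≟ s′) (j ∈? Q)
      where
      open DecMembership (_≟_ {ℓ}) using (_∈?_)
      K : ℤ
      K = + (m !) * c
      P : ℤ
      P = ∏ (map a Q)
      sQ-unique : Unique (s ∷ Q)
      sQ-unique = s≢Q ∷ Q-unique
      s′Q-unique : Unique (s′ ∷ Q)
      s′Q-unique = s′≢Q ∷ Q-unique
      |sQ|≡1+m : length (s ∷ Q) ≡ suc m
      |sQ|≡1+m = cong suc |Q|≡m

      evaluate : ∀ {j x y d d′} → V (s ∷ Q) off j ≡ x → V (s′ ∷ Q) off j ≡ y →
                 δ s j ≡ d → δ s′ j ≡ d′ →
                 a s′ * x - a s * y ≡ K * P * (a s′ * d - a s * d′) →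
                 a s′ * V (s ∷ Q) off j - a s * V (s′ ∷ Q) off j ≡ K * P * (a s′ * δ s j - a s * δ s′ j)
      evaluate refl refl refl refl identity = identity

      by-cases : ∀ j → Dec (j ≡ s) → Dec (j ≡ s′) → Dec (j ∈ Q) →
                 a s′ * V (s ∷ Q) off j - a s * V (s′ ∷ Q) off j ≡ K * P * (a s′ * δ s j - a s * δ s′ j)
      by-cases .s (yes refl) _ _ = evaluate
        (V-off-inside (s ∷ Q) s sQ-unique |sQ|≡1+m (here refl))
        (V-off-outside (s′ ∷ Q) s s′Q-unique (All¬⇒¬Any (s≢s′ ∷ s≢Q)))
        (δ-diag s) (δ-off s′ s (s≢s′ ∘ sym)) (at-s (a s) (a s′) K P)
        where at-s : ∀ x y K P → y * (K * P) - x * + 0 ≡ K * P * (y * + 1 - x * + 0)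
              at-s = solve-∀
      by-cases .s′ (no _) (yes refl) _ = evaluate
        (V-off-outside (s ∷ Q) s′ sQ-unique (All¬⇒¬Any ((s≢s′ ∘ sym) ∷ s′≢Q)))
        (V-off-inside (s′ ∷ Q) s′ s′Q-unique |sQ|≡1+m (here refl))
        (δ-off s s′ s≢s′) (δ-diag s′) (at-s′ (a s) (a s′) K P)
        where at-s′ : ∀ x y K P → y * + 0 - x * (K * P) ≡ K * P * (y * + 0 - x * + 1)
              at-s′ = solve-∀
      by-cases j (no j≢s) (no j≢s′) (yes j∈Q) = evaluate
        (V-off-inside (s ∷ Q) j sQ-unique |sQ|≡1+m (there j∈Q))
        (V-off-inside (s′ ∷ Q) j s′Q-unique |sQ|≡1+m (there j∈Q))
        (δ-off s j (j≢s ∘ sym)) (δ-off s′ j (j≢s′ ∘ sym)) (in-Q (a s) (a s′) K P (∏ (map a (Q ─ j∈Q))))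
        where in-Q : ∀ x y K P R → y * (K * (x * R)) - x * (K * (y * R)) ≡ K * P * (y * + 0 - x * + 0)
              in-Q = solve-∀
      by-cases j (no j≢s) (no j≢s′) (no j∉Q) = evaluate
        (V-off-outside (s ∷ Q) j sQ-unique λ { (here j≡s) → j≢s j≡s ; (there j∈Q) → j∉Q j∈Q })
        (V-off-outside (s′ ∷ Q) j s′Q-unique λ { (here j≡s′) → j≢s′ j≡s′ ; (there j∈Q) → j∉Q j∈Q })
        (δ-off s j (j≢s ∘ sym)) (δ-off s′ j (j≢s′ ∘ sym)) (elsewhere (a s) (a s′) K P)
        where elsewhere : ∀ x y K P → y * + 0 - x * + 0 ≡ K * P * (y * + 0 - x * + 0)
              elsewhere = solve-∀

-- Congruence modulo p, phrased with signed divisibility (whose library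
-- has the closure lemmas we need); the record makes x and y inferable.
module Congruence (p : ℕ) where

  infix 4 _≈_
  record _≈_ (x y : ℤ) : Set where
    constructor by-divisibility
    field p∣x-y : + p Signed.∣ x - y
  open _≈_ public

  ≈⇒≡[mod] : ∀ x y → x ≈ y → x ≡[mod p ] y
  ≈⇒≡[mod] _ _ e = Signed.∣⇒∣ᵤ (p∣x-y e)

  ≡[mod]⇒≈ : ∀ x y → x ≡[mod p ] y → x ≈ y
  ≡[mod]⇒≈ _ _ e = by-divisibility (Signed.∣ᵤ⇒∣ e)

  ∣-≡ : ∀ {x y} → x ≡ y → + p Signed.∣ x → + p Signed.∣ y
  ∣-≡ refl d = d

  ≈-reflexive : ∀ {x y} → x ≡ y → x ≈ y
  ≈-reflexive {x} refl = by-divisibility (∣-≡ (sym (ℤₚ.+-inverseʳ x)) (Signed.divides (+ 0) refl))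

  ≈-sym : ∀ {x y} → x ≈ y → y ≈ x
  ≈-sym {x} {y} e = by-divisibility (∣-≡ (negate x y) (Signed.∣m⇒∣-m (p∣x-y e)))
    where negate : ∀ x y → - (x - y) ≡ y - x
          negate = solve-∀

  ≈-trans : ∀ {x y z} → x ≈ y → y ≈ z → x ≈ z
  ≈-trans {x} {y} {z} e f = by-divisibility (∣-≡ (telescope x y z) (Signed.∣m∣n⇒∣m+n (p∣x-y e) (p∣x-y f)))
    where telescope : ∀ x y z → (x - y) + (y - z) ≡ x - z
          telescope = solve-∀

  ≈-isEquivalence : IsEquivalence _≈_
  ≈-isEquivalence = record { refl = ≈-reflexive refl ; sym = ≈-sym ; trans = ≈-trans }

  ≈-setoid : Setoid _ _
  ≈-setoid = record { isEquivalence = ≈-isEquivalence }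

  module ≈-Reasoning = SetoidReasoning ≈-setoid

  ≈-refl : ∀ {x} → x ≈ x
  ≈-refl = ≈-reflexive refl

  +-cong : ∀ {x x′ y y′} → x ≈ x′ → y ≈ y′ → x + y ≈ x′ + y′
  +-cong {x} {x′} {y} {y′} e f =
    by-divisibility (∣-≡ (regroup x x′ y y′) (Signed.∣m∣n⇒∣m+n (p∣x-y e) (p∣x-y f)))
    where regroup : ∀ x x′ y y′ → (x - x′) + (y - y′) ≡ (x + y) - (x′ + y′)
          regroup = solve-∀

  *-cong : ∀ {x x′ y y′} → x ≈ x′ → y ≈ y′ → x * y ≈ x′ * y′
  *-cong {x} {x′} {y} {y′} e f =
    by-divisibility (∣-≡ (regroup x x′ y y′)
      (Signed.∣m∣n⇒∣m+n (Signed.∣n⇒∣m*n x (p∣x-y f)) (Signed.∣m⇒∣m*n y′ (p∣x-y e))))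
    where regroup : ∀ x x′ y y′ → x * (y - y′) + (x - x′) * y′ ≡ x * y - x′ * y′
          regroup = solve-∀

  *-congˡ : ∀ x {y y′} → y ≈ y′ → x * y ≈ x * y′
  *-congˡ x = *-cong (≈-refl {x})

  *-congʳ : ∀ {x x′} y → x ≈ x′ → x * y ≈ x′ * y
  *-congʳ y e = *-cong e (≈-refl {y})

  ∣⇒≈0 : ∀ {x} → + p Signed.∣ x → x ≈ + 0
  ∣⇒≈0 {x} d = by-divisibility (∣-≡ (sym (ℤₚ.+-identityʳ x)) d)

  ≈0⇒∣ : ∀ {x} → x ≈ + 0 → + p Signed.∣ x
  ≈0⇒∣ {x} e = ∣-≡ (ℤₚ.+-identityʳ x) (p∣x-y e)

  ≈0-*ʳ : ∀ {x} y → x ≈ + 0 → x * y ≈ + 0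
  ≈0-*ʳ y e = ∣⇒≈0 (Signed.∣m⇒∣m*n y (≈0⇒∣ e))

  ≈0-*ˡ : ∀ x {y} → y ≈ + 0 → x * y ≈ + 0
  ≈0-*ˡ x e = ∣⇒≈0 (Signed.∣n⇒∣m*n x (≈0⇒∣ e))

  ∑-cong : ∀ n {f g : Fin n → ℤ} → (∀ i → f i ≈ g i) → ∑ n f ≈ ∑ n g
  ∑-cong zero    _   = ≈-refl
  ∑-cong (suc n) f≈g = +-cong (f≈g zero) (∑-cong n (f≈g ∘ suc))

  infix 4 _≈?_
  _≈?_ : ∀ x y → Dec (x ≈ y)
  x ≈? y with p ℕ∣.∣? ∣ x - y ∣
  ... | yes p∣ = yes (≡[mod]⇒≈ x y p∣)
  ... | no p∤ = no λ e → p∤ (≈⇒≡[mod] x y e)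

  roots≤-root : ∀ m r y → 0 < r → r ≤ m → y ≈ + r → roots≤ m y ≈ + 0
  roots≤-root zero    r y 0<r r≤0 _ = ⊥-elim (ℕₚ.<⇒≱ 0<r r≤0)
  roots≤-root (suc m) r y 0<r r≤1+m y≈r with r ℕ.≟ suc m
  ... | yes refl   = ≈0-*ʳ (roots≤ m y) (∣⇒≈0 (p∣x-y y≈r))
  ... | no r≢1+m = ≈0-*ˡ (y - + suc m) (roots≤-root m r y 0<r (ℕₚ.≤-pred (ℕₚ.≤∧≢⇒< r≤1+m r≢1+m)) y≈r)

module PrimeModulus (p : ℕ) (p-prime : Prime p) where
  open Congruence p

  open ≡-Reasoning

  instance
    p≢0 : ℕ.NonZero p
    p≢0 = prime⇒nonZero p-prime

  ↑-affine : ∀ a b c → + (a ℕ.+ b ℕ.* c) ≡ + a + + b * + c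
  ↑-affine a b c = trans (ℤₚ.pos-+ a (b ℕ.* c)) (cong (λ z → + a + z) (ℤₚ.pos-* b c))

  ≈-residue : ∀ x → x ≈ + (x %ℕ p)
  ≈-residue x = by-divisibility (Signed.divides (x /ℕ p) (begin
      x - + (x %ℕ p)                       ≡⟨ cong (_- + (x %ℕ p)) (a≡a%ℕn+[a/ℕn]*n x p) ⟩
      + (x %ℕ p) + x /ℕ p * + p - + (x %ℕ p) ≡⟨ cancel (+ (x %ℕ p)) (x /ℕ p * + p) ⟩
      x /ℕ p * + p                          ∎))
    where cancel : ∀ r m → r + m - r ≡ m
          cancel = solve-∀

  residue-positive : ∀ x → ¬ x ≈ + 0 → 0 < x %ℕ p
  residue-positive x x≉0 with x %ℕ p | ≈-residue x
  ... | zero  | x≈0 = ⊥-elim (x≉0 x≈0)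
  ... | suc _ | _   = s≤s z≤n

  no-zero-divisors : ∀ x y → x * y ≈ + 0 → x ≈ + 0 ⊎ y ≈ + 0
  no-zero-divisors x y xy≈0
    with euclidsLemma ∣ x ∣ ∣ y ∣ p-prime
           (subst (p ℕ∣.∣_) (ℤₚ.abs-* x y) (Signed.∣⇒∣ᵤ (≈0⇒∣ xy≈0)))
  ... | inj₁ p∣x = inj₁ (∣⇒≈0 (Signed.∣ᵤ⇒∣ p∣x))
  ... | inj₂ p∣y = inj₂ (∣⇒≈0 (Signed.∣ᵤ⇒∣ p∣y))

  nonzero-* : ∀ {x y} → ¬ x ≈ + 0 → ¬ y ≈ + 0 → ¬ x * y ≈ + 0
  nonzero-* {x} {y} x≉0 y≉0 xy≈0 with no-zero-divisors x y xy≈0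
  ... | inj₁ x≈0 = x≉0 x≈0
  ... | inj₂ y≈0 = y≉0 y≈0

  1≉0 : ¬ + 1 ≈ + 0
  1≉0 1≈0 with ℕ∣.∣1⇒≡1 (Signed.∣⇒∣ᵤ (≈0⇒∣ 1≈0))
  ... | p≡1 = ℕₚ.<⇒≢ (ℕ.nonTrivial⇒n>1 p {{prime⇒nonTrivial p-prime}}) (sym p≡1)

  -- m! is a product of factors smaller than p.
  factorial≉0 : ∀ m → m < p → ¬ + (m !) ≈ + 0
  factorial≉0 zero    _   = 1≉0
  factorial≉0 (suc m) m<p m!≈0
    with euclidsLemma (suc m) (m !) p-prime (Signed.∣⇒∣ᵤ (≈0⇒∣ m!≈0))
  ... | inj₁ p∣m+1 = ℕₚ.<⇒≱ m<p (ℕ∣.∣⇒≤ p∣m+1)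
  ... | inj₂ p∣m!  = factorial≉0 m (ℕₚ.<-trans (ℕₚ.n<1+n m) m<p) (∣⇒≈0 (Signed.∣ᵤ⇒∣ p∣m!))

  -- Every r with 0 < r < p is coprime to p, so Bézout's identity
  -- 1 + y r = x p  (or 1 + x p = y r) exhibits an inverse of r.
  inverse-residue : ∀ r → 0 < r → r < p → Σ ℤ λ y → + r * y ≈ + 1
  inverse-residue r@(suc _) _ r<p with coprime-Bézout (prime⇒coprime p-prime r<p)
  ... | Bézout.+- x y eq = - + y , ≈-sym (by-divisibility (Signed.divides (+ x) (begin
      + 1 - + r * - + y  ≡⟨ rearrange (+ r) (+ y) ⟩
      + 1 + + y * + r    ≡⟨ ↑-affine 1 y r ⟨
      + (1 ℕ.+ y ℕ.* r)  ≡⟨ cong +_ eq ⟩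
      + (x ℕ.* p)        ≡⟨ ℤₚ.pos-* x p ⟩
      + x * + p          ∎)))
    where rearrange : ∀ r y → + 1 - r * - y ≡ + 1 + y * r
          rearrange = solve-∀
  ... | Bézout.-+ x y eq = + y , by-divisibility (Signed.divides (+ x) (begin
      + r * + y - + 1          ≡⟨ rearrange (+ r) (+ y) ⟩
      + y * + r - + 1          ≡⟨ cong (_- + 1) (ℤₚ.pos-* y r) ⟨
      + (y ℕ.* r) - + 1        ≡⟨ cong (λ z → + z - + 1) eq ⟨
      + (1 ℕ.+ x ℕ.* p) - + 1  ≡⟨ cong (_- + 1) (↑-affine 1 x p) ⟩
      + 1 + + x * + p - + 1    ≡⟨ cancel (+ x * + p) ⟩
      + x * + p                ∎))
    where rearrange : ∀ r y → r * y - + 1 ≡ y * r - + 1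
          rearrange = solve-∀
          cancel : ∀ q → + 1 + q - + 1 ≡ q
          cancel = solve-∀

  inverse : ∀ x → ¬ x ≈ + 0 → Σ ℤ λ y → x * y ≈ + 1
  inverse x x≉0 with inverse-residue (x %ℕ p) (residue-positive x x≉0) (n%ℕd<d x p)
  ... | y , ry≈1 = y , ≈-trans (*-congʳ y (≈-residue x)) ry≈1

  roots≤-vanishes : ∀ y → ¬ y ≈ + 0 → roots≤ (ℕ.pred p) y ≈ + 0
  roots≤-vanishes y y≉0 =
    roots≤-root (ℕ.pred p) (y %ℕ p) y (residue-positive y y≉0) (ℕₚ.<⇒≤pred (n%ℕd<d y p)) (≈-residue y)

module SolutionSpan (p ℓ : ℕ) (a : Vec𝔽 ℓ) where
  open Congruence p

  _≈ᵛ_ : Vec𝔽 ℓ → Vec𝔽 ℓ → Set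
  u ≈ᵛ v = ∀ j → u j ≈ v j

  -- The span as the inductively generated subspace: it contains the
  -- solutions and is closed under the vector-space operations.
  data Spanned : Vec𝔽 ℓ → Set where
    solution : ∀ x → IsSol p ℓ a x → Spanned (toVec x)
    zeroᵛ    : Spanned (λ _ → + 0)
    add      : ∀ {u v} → Spanned u → Spanned v → Spanned (λ j → u j + v j)
    scale    : ∀ {u} c → Spanned u → Spanned (λ j → c * u j)
    resp     : ∀ {u v} → u ≈ᵛ v → Spanned u → Spanned v

  Span : Vec𝔽 ℓ → Set
  Span = InSpan p ℓ (InS p ℓ a)

  span-by : ∀ v m c w → (∀ k → InS p ℓ a (w k)) → v ≈ᵛ lincomb m c w → Span v
  span-by v m c w w-sol v≈ = m , c , w , w-sol , λ j → ≈⇒≡[mod] (v j) (lincomb m c w j) (v≈ j)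

  span-≈ᵛ : ∀ v ((m , c , w , _) : Span v) → v ≈ᵛ lincomb m c w
  span-≈ᵛ v (m , c , w , _ , v≈) j = ≡[mod]⇒≈ (v j) (lincomb m c w j) (v≈ j)

  spanned⇒Span : ∀ {v} → Spanned v → Span v
  spanned⇒Span (solution x x-sol) =
    span-by (toVec x) 1 (λ _ → + 1) (λ _ → toVec x)
      (λ _ → x , x-sol , λ j → ≈⇒≡[mod] (bit (x j)) (bit (x j)) ≈-refl)
      λ j → ≈-reflexive (sym (trans (ℤₚ.+-identityʳ _) (ℤₚ.*-identityˡ _)))
  spanned⇒Span zeroᵛ = span-by (λ _ → + 0) 0 (λ ()) (λ ()) (λ ()) λ j → ≈-refl
  spanned⇒Span (add {u} {v} su sv) with spanned⇒Span su | spanned⇒Span sv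
  ... | Su@(m , c , w , w-sol , _) | Sv@(n , c′ , w′ , w′-sol , _) =
    span-by (λ j → u j + v j) (m ℕ.+ n) (c ++ c′) (w ++ w′)
      (λ k → Sum.[_,_] {C = λ x → InS p ℓ a (Sum.[ w , w′ ]′ x)} w-sol w′-sol (splitAt m k))
      λ j → ≈-trans (+-cong (span-≈ᵛ u Su j) (span-≈ᵛ v Sv j)) (≈-reflexive (sym (lincomb-++ m c c′ w w′ j)))
  spanned⇒Span (scale {u} d su) with spanned⇒Span su
  ... | Su@(m , c , w , w-sol , _) =
    span-by (λ j → d * u j) m (λ k → d * c k) w w-sol
      λ j → ≈-trans (*-congˡ d (span-≈ᵛ u Su j)) (≈-reflexive (sym (lincomb-scale m d c w j)))
  spanned⇒Span (resp {u} {v} u≈v su) with spanned⇒Span su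
  ... | Su@(m , c , w , w-sol , _) = span-by v m c w w-sol λ j → ≈-trans (≈-sym (u≈v j)) (span-≈ᵛ u Su j)

  difference : ∀ {u v} → Spanned u → Spanned v → Spanned (λ j → u j - v j)
  difference {u} {v} su sv = resp (λ j → ≈-reflexive (minus (u j) (v j))) (add su (scale (- + 1) sv))
    where minus : ∀ x y → x + - + 1 * y ≡ x - y
          minus = solve-∀

  unscale : ∀ {u} c w → c * w ≈ + 1 → Spanned (λ j → c * u j) → Spanned u
  unscale {u} c w cw≈1 scu = resp (λ j → begin
      w * (c * u j)  ≡⟨ regroup w c (u j) ⟩
      c * w * u j    ≈⟨ *-congʳ (u j) cw≈1 ⟩
      + 1 * u j      ≡⟨ ℤₚ.*-identityˡ (u j) ⟩
      u j            ∎) (scale w scu)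
    where open ≈-Reasoning
          regroup : ∀ w c x → w * (c * x) ≡ c * w * x
          regroup = solve-∀

  -- If g vanishes at every nonzero residue, every alternating sum V S u
  -- lies in the span: each g(a·x) x is either 0 or a multiple of a solution.
  module _ (g : ℤ → ℤ) (g-vanishes : ∀ y → ¬ y ≈ + 0 → g y ≈ + 0) where
    open AlternatingSums a g

    V-spanned : ∀ S u → Spanned (V S u)
    V-spanned [] u with σ u ≈? + 0
    ... | yes σu≈0 = scale (g (σ u)) (solution u (≈⇒≡[mod] (σ u) (+ 0) σu≈0))
    ... | no  σu≉0 = resp (λ j → ≈-sym (≈0-*ʳ (bit (u j)) (g-vanishes (σ u) σu≉0))) zeroᵛ
    V-spanned (t ∷ S) u = difference (V-spanned S (switchOn u t)) (V-spanned S u)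

  Span-orthogonal : ∀ v → Span v → a · v ≈ + 0
  Span-orthogonal v Sv@(m , c , w , w-sol , _) = begin
    a · v                        ≈⟨ ∑-cong ℓ (λ j → *-congˡ (a j) (span-≈ᵛ v Sv j)) ⟩
    a · lincomb m c w            ≡⟨ ·-lincomb a m c w ⟩
    ∑ m (λ k → c k * (a · w k))  ≈⟨ ∑-cong m (λ k → ≈0-*ˡ (c k) (solution-orthogonal (w-sol k))) ⟩
    ∑ m (λ _ → + 0)              ≡⟨ ∑-zero m ⟩
    + 0                          ∎
    where
      open ≈-Reasoning
      solution-orthogonal : ∀ {u} → InS p ℓ a u → a · u ≈ + 0
      solution-orthogonal {u} (x , x-sol , u≈x) =
        ≈-trans (∑-cong ℓ (λ j → *-congˡ (a j) (≡[mod]⇒≈ (u j) (bit (x j)) (u≈x j))))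
                (≡[mod]⇒≈ (a · toVec x) (+ 0) x-sol)

module Basis (p : ℕ) (p-prime : Prime p) (n : ℕ) (p≤1+n : p ≤ suc n)
             (a : Vec𝔽 (suc (suc n))) (a≉0 : AllNonzero p (suc (suc n)) a) where
  open Congruence p
  open PrimeModulus p p-prime
  open SolutionSpan p (suc (suc n)) a
  open AlternatingSums a (roots≤ (ℕ.pred p))

  ℓ : ℕ
  ℓ = suc (suc n)

  m : ℕ
  m = ℕ.pred p

  b : Fin (suc n) → Vec𝔽 ℓ
  b k j = a zero * δ (suc k) j - a (suc k) * δ zero j

  -- m = p − 1 coordinates other than 0 and k + 1 (there are n ≥ m of them).
  others : Fin (suc n) → List (Fin ℓ)
  others k = tabulate (λ i → suc (punchIn k (inject≤ i (ℕₚ.pred-mono-≤ p≤1+n))))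

  others-length : ∀ k → length (others k) ≡ m
  others-length k = length-tabulate _

  others-unique : ∀ k → Unique (suc k ∷ zero ∷ others k)
  others-unique k =
    ((λ ()) ∷ tabulate⁺ (λ i k+1≡ → Finₚ.punchInᵢ≢i k _ (sym (Finₚ.suc-injective k+1≡)))) ∷
    tabulate⁺ (λ i ()) ∷
    Unique.tabulate⁺ (λ eq → Finₚ.inject≤-injective _ _ _ _ (Finₚ.punchIn-injective k _ _ (Finₚ.suc-injective eq)))

  a-nonzero : ∀ i → ¬ a i ≈ + 0
  a-nonzero i ai≈0 = a≉0 i (≈⇒≡[mod] (a i) (+ 0) ai≈0)

  ∏-nonzero : ∀ is → ¬ ∏ (map a is) ≈ + 0
  ∏-nonzero []       = 1≉0
  ∏-nonzero (i ∷ is) = nonzero-* (a-nonzero i) (∏-nonzero is)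

  -- Each b k is spanned: pair-combination (with s = k+1, s′ = 0) writes the
  -- invertible multiple K ∏ a(Q) of it as a combination of two spanned
  -- alternating sums.
  b-spanned : ∀ k → Spanned (b k)
  b-spanned k = unscale (K * ∏ (map a Q)) w KP·w≈1
      (resp (λ j → ≈-reflexive (pair-combination (roots≤-Poly m) (suc k) zero Q (others-unique k) (others-length k) j))
        (difference (scale (a zero) (V-spanned (roots≤ m) roots≤-vanishes (suc k ∷ Q) off))
                    (scale (a (suc k)) (V-spanned (roots≤ m) roots≤-vanishes (zero ∷ Q) off))))
    where
      Q : List (Fin ℓ)
      Q = others k
      -- The constant (p−1)! · 1 of the (p−1)-th differences of roots≤ (p−1).
      K : ℤ
      K = + (m !) * + 1
      K≉0 : ¬ K ≈ + 0
      K≉0 = nonzero-* (factorial≉0 m (ℕₚ.≤-reflexive (ℕₚ.suc-pred p))) 1≉0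
      KP-invertible : Σ ℤ λ w → K * ∏ (map a Q) * w ≈ + 1
      KP-invertible = inverse (K * ∏ (map a Q)) (nonzero-* K≉0 (∏-nonzero Q))
      w : ℤ
      w = proj₁ KP-invertible
      KP·w≈1 : K * ∏ (map a Q) * w ≈ + 1
      KP·w≈1 = proj₂ KP-invertible

  lincomb-b-suc : ∀ c k → lincomb (suc n) c b (suc k) ≡ c k * a zero
  lincomb-b-suc c k =
    trans (∑-ext (suc n) (λ k′ → drop (c k′) (a zero) (δ k′ k) (a (suc k′))))
          (∑-δ (suc n) (λ k′ → c k′ * a zero) k)
    where drop : ∀ c x d y → c * (x * d - y * + 0) ≡ c * x * d
          drop = solve-∀

  -- Hence the b's are independent, as a₀ ≢ 0.
  b-independent : LinIndep p ℓ (suc n) b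
  b-independent c comb≡0 k =
    Sum.[ ≈⇒≡[mod] (c k) (+ 0) , (λ a₀≈0 → ⊥-elim (a-nonzero zero a₀≈0)) ]′
      (no-zero-divisors (c k) (a zero) cₖa₀≈0)
    where cₖa₀≈0 : c k * a zero ≈ + 0
          cₖa₀≈0 = ≈-trans (≈-reflexive (sym (lincomb-b-suc c k)))
                           (≡[mod]⇒≈ (lincomb (suc n) c b (suc k)) (+ 0) (comb≡0 (suc k)))

  module _ (w₀ : ℤ) (a₀w₀≈1 : a zero * w₀ ≈ + 1) where
    open ≈-Reasoning

    hyperplane-expansion : ∀ v → a · v ≈ + 0 → v ≈ᵛ lincomb (suc n) (λ k → w₀ * v (suc k)) b
    hyperplane-expansion v a·v≈0 zero = ≈-sym (begin
      ∑ (suc n) (λ k → w₀ * v (suc k) * (a zero * + 0 - a (suc k) * + 1))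
        ≡⟨ ∑-ext (suc n) (λ k → pull (a zero) (a (suc k)) w₀ (v (suc k))) ⟩
      ∑ (suc n) (λ k → - w₀ * (a (suc k) * v (suc k)))
        ≡⟨ ∑-*ˡ (suc n) (- w₀) (λ k → a (suc k) * v (suc k)) ⟩
      - w₀ * T
        ≈⟨ *-congˡ (- w₀) T≈-a₀v₀ ⟩
      - w₀ * - (a zero * v zero)
        ≡⟨ regroup w₀ (a zero) (v zero) ⟩
      a zero * w₀ * v zero
        ≈⟨ *-congʳ (v zero) a₀w₀≈1 ⟩
      + 1 * v zero
        ≡⟨ ℤₚ.*-identityˡ (v zero) ⟩
      v zero ∎)
      where
        T : ℤ
        T = ∑ (suc n) (λ k → a (suc k) * v (suc k))
        pull : ∀ x y w u → w * u * (x * + 0 - y * + 1) ≡ - w * (y * u)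
        pull = solve-∀
        regroup : ∀ w x u → - w * - (x * u) ≡ x * w * u
        regroup = solve-∀
        T≈-a₀v₀ : T ≈ - (a zero * v zero)
        T≈-a₀v₀ = begin
          T                                   ≡⟨ isolate (a zero * v zero) T ⟩
          - (a zero * v zero) + a · v         ≈⟨ +-cong (≈-refl { - (a zero * v zero)}) a·v≈0 ⟩
          - (a zero * v zero) + + 0           ≡⟨ ℤₚ.+-identityʳ _ ⟩
          - (a zero * v zero)                 ∎
          where isolate : ∀ x t → t ≡ - x + (x + t)
                isolate = solve-∀
    hyperplane-expansion v _ (suc k) = ≈-sym (begin
      lincomb (suc n) (λ k → w₀ * v (suc k)) b (suc k)  ≡⟨ lincomb-b-suc (λ k → w₀ * v (suc k)) k ⟩
      w₀ * v (suc k) * a zero                           ≡⟨ regroup w₀ (v (suc k)) (a zero) ⟩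
      a zero * w₀ * v (suc k)                           ≈⟨ *-congʳ (v (suc k)) a₀w₀≈1 ⟩
      + 1 * v (suc k)                                   ≡⟨ ℤₚ.*-identityˡ (v (suc k)) ⟩
      v (suc k)                                         ∎)
      where regroup : ∀ w u x → w * u * x ≡ x * w * u
            regroup = solve-∀

  -- Every vector of the span lies in the hyperplane, hence is a combination of the b's.
  b-spans : ∀ v → Span v → Σ (Fin (suc n) → ℤ) λ c → v ≈[ p ] lincomb (suc n) c b
  b-spans v v∈span = (λ k → w₀ * v (suc k)) ,
    λ j → ≈⇒≡[mod] (v j) (lincomb (suc n) (λ k → w₀ * v (suc k)) b j)
                   (hyperplane-expansion w₀ a₀w₀≈1 v (Span-orthogonal v v∈span) j)
    where w₀ : ℤ
          w₀ = proj₁ (inverse (a zero) (a-nonzero zero))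
          a₀w₀≈1 : a zero * w₀ ≈ + 1
          a₀w₀≈1 = proj₂ (inverse (a zero) (a-nonzero zero))

  basis : DimIs p ℓ a (suc n)
  basis = b , (λ k → spanned⇒Span (b-spanned k)) , b-independent , b-spans

-- ℓ > p ≥ 2 forces ℓ = n + 2 with p ≤ n + 1 (and ℓ = 1 would force p = 0).
theorem1p1 : (p : ℕ) → Prime p → (ℓ : ℕ) → p < ℓ → (a : Fin ℓ → ℤ) →
             AllNonzero p ℓ a → DimIs p ℓ a (ℓ ∸ 1)
theorem1p1 p p-prime (suc (suc n)) (s≤s p≤1+n) a a≉0 = Basis.basis p p-prime n p≤1+n a a≉0
theorem1p1 .0 p-prime (suc zero) (s≤s z≤n) a a≉0 = ⊥-elim (ℕ.NonZero.nonZero (prime⇒nonZero p-prime))
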